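{- Let $\{V_n\}_{n\geq 0}$ be the sequence defined by $V_0=1$, $V_1=8$ and \[ n(n+1)^2 V_{n+1}=8n(3n^2+5n+1)V_n-128(n-1)(n+1)^2V_{n-1}, \quad \text{for } n\geq 1. \] Then $V_n^2\geq V_{n-1}V_{n+1}$ for every $n\geq 2$.
   Context: The sequence $\{V_n\}$ is the Fennessey-Larcombe-French sequence. -}

module Defs where

open import Data.Nat using (ℕ; zero; suc)
import Data.Nat as ℕ
open import Data.Integer using (+_)
open import Data.Rational using (ℚ; _/_; _+_; _*_; _-_; 1ℚ)
open import Relation.Binary.PropositionalEquality using (_≡_)
open import Data.Product using (_×_)

ℕ→ℚ : ℕ → ℚ
ℕ→ℚ n = + n / 1

-- Since n(n+1)² ≠ 0 for n ≥ 1, this determines V uniquely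
-- (the Fennessey–Larcombe–French sequence).
IsFLF : (ℕ → ℚ) → Set
IsFLF V =
  (V 0 ≡ 1ℚ) × (V 1 ≡ ℕ→ℚ 8) ×
  (∀ (m : ℕ) → let n = suc m in
     ℕ→ℚ (n ℕ.* (n ℕ.+ 1) ℕ.* (n ℕ.+ 1)) * V (suc n)
       ≡ ℕ→ℚ (8 ℕ.* n ℕ.* (3 ℕ.* n ℕ.* n ℕ.+ 5 ℕ.* n ℕ.+ 1)) * V n
         - ℕ→ℚ (128 ℕ.* m ℕ.* (n ℕ.+ 1) ℕ.* (n ℕ.+ 1)) * V m)

module Submission where

-- Write the recurrence as  a(M) V_{m+2} = b(M) V_{m+1} − c(M) V_m  with M = m and
-- polynomial coefficients a, b, c.  After the embedding ℕ → ℚ and some sign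
-- bookkeeping, the file develops three ingredients.
--   * Generic facts about a three-term step  a·w = b·z − c·y  over ℚ: a lower ratio
--     bound ρ ≤ z/y, an upper ratio bound z/y ≤ p/q, and log-concavity propagate from
--     (y, z) to (z, w), provided certain expressions in the coefficients are
--     nonnegative.  Each is proved by one ring identity exhibiting k·(rhs − lhs) as a
--     manifestly nonnegative expression (plus multiples of the vanishing step residue).
--   * For the FLF coefficients those expressions are explicit: 16 b − 256 a − c = 128,
--     the Casoratians c(M+1)a(M) − c(M)a(M+1) and c(M+1)b(M) − c(M)b(M+1) equal
--     128 Q(M) and 128 P(M), and the upper-bound propagation defect is 64 E(M), where
--     P, Q, E have nonnegative coefficients.  All are checked by the ring solver.
--   * By induction, 16 V_{m+1} ≤ V_{m+2} ≤ (P/Q)(m) V_{m+1}.  The upper bound is exactly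
--     what the Casoratian identities require, so log-concavity propagates from its
--     base case V₁V₃ ≤ V₂², which is the final induction proving theorem2p2.

open import Defs
open import Data.Nat using (ℕ; suc)
open import Data.Rational using (ℚ; _*_; _≤_)

open import Data.Nat using (zero)
import Data.Nat as ℕ
import Data.Integer as ℤ
import Data.Integer.Properties as ℤ
open import Data.Rational
  using (0ℚ; 1ℚ; _+_; _-_; -_; _<_; _≤?_; toℚᵘ; positive; nonNegative)
open import Data.Rational.Properties
import Data.Rational.Unnormalised as ℚᵘ
import Data.Rational.Unnormalised.Properties as ℚᵘ
open import Data.Rational.Solver using (module +-*-Solver)
open import Data.Fin using (zero)
open import Data.Vec using ([]; _∷_)
open import Data.List using (List; []; _∷_)
open import Data.Product using (proj₁; proj₂)
open import Relation.Nullary.Decidable using (True; toWitness)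
open import Relation.Binary.PropositionalEquality
open +-*-Solver

ℕ→ℚᵘ : ℕ → ℚᵘ.ℚᵘ
ℕ→ℚᵘ n = ℚᵘ.mkℚᵘ (ℤ.+ n) 0

toℚᵘ-ℕ→ℚ : ∀ n → toℚᵘ (ℕ→ℚ n) ℚᵘ.≃ ℕ→ℚᵘ n
toℚᵘ-ℕ→ℚ n = toℚᵘ-fromℚᵘ (ℕ→ℚᵘ n)

ℕ→ℚᵘ-+ : ∀ m n → ℕ→ℚᵘ (m ℕ.+ n) ℚᵘ.≃ ℕ→ℚᵘ m ℚᵘ.+ ℕ→ℚᵘ n
ℕ→ℚᵘ-+ m n = ℚᵘ.*≡* (cong (ℤ._* ℤ.+ 1)
  (trans (ℤ.pos-+ m n) (sym (cong₂ ℤ._+_ (ℤ.*-identityʳ (ℤ.+ m)) (ℤ.*-identityʳ (ℤ.+ n))))))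

ℕ→ℚᵘ-* : ∀ m n → ℕ→ℚᵘ (m ℕ.* n) ℚᵘ.≃ ℕ→ℚᵘ m ℚᵘ.* ℕ→ℚᵘ n
ℕ→ℚᵘ-* m n = ℚᵘ.*≡* (cong (ℤ._* ℤ.+ 1) (ℤ.pos-* m n))

ℕ→ℚ-+ : ∀ m n → ℕ→ℚ (m ℕ.+ n) ≡ ℕ→ℚ m + ℕ→ℚ n
ℕ→ℚ-+ m n = toℚᵘ-injective (begin-equality
  toℚᵘ (ℕ→ℚ (m ℕ.+ n))                 ≃⟨ toℚᵘ-ℕ→ℚ (m ℕ.+ n) ⟩
  ℕ→ℚᵘ (m ℕ.+ n)                       ≃⟨ ℕ→ℚᵘ-+ m n ⟩
  ℕ→ℚᵘ m ℚᵘ.+ ℕ→ℚᵘ n                   ≃⟨ ℚᵘ.+-cong (toℚᵘ-ℕ→ℚ m) (toℚᵘ-ℕ→ℚ n) ⟨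
  toℚᵘ (ℕ→ℚ m) ℚᵘ.+ toℚᵘ (ℕ→ℚ n)       ≃⟨ toℚᵘ-homo-+ (ℕ→ℚ m) (ℕ→ℚ n) ⟨
  toℚᵘ (ℕ→ℚ m + ℕ→ℚ n)                 ∎)
  where open ℚᵘ.≤-Reasoning

ℕ→ℚ-* : ∀ m n → ℕ→ℚ (m ℕ.* n) ≡ ℕ→ℚ m * ℕ→ℚ n
ℕ→ℚ-* m n = toℚᵘ-injective (begin-equality
  toℚᵘ (ℕ→ℚ (m ℕ.* n))                 ≃⟨ toℚᵘ-ℕ→ℚ (m ℕ.* n) ⟩
  ℕ→ℚᵘ (m ℕ.* n)                       ≃⟨ ℕ→ℚᵘ-* m n ⟩
  ℕ→ℚᵘ m ℚᵘ.* ℕ→ℚᵘ n                   ≃⟨ ℚᵘ.*-cong (toℚᵘ-ℕ→ℚ m) (toℚᵘ-ℕ→ℚ n) ⟨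
  toℚᵘ (ℕ→ℚ m) ℚᵘ.* toℚᵘ (ℕ→ℚ n)       ≃⟨ toℚᵘ-homo-* (ℕ→ℚ m) (ℕ→ℚ n) ⟨
  toℚᵘ (ℕ→ℚ m * ℕ→ℚ n)                 ∎)
  where open ℚᵘ.≤-Reasoning

ℕ→ℚ-nonNeg : ∀ n → 0ℚ ≤ ℕ→ℚ n
ℕ→ℚ-nonNeg n = nonNegative⁻¹ (ℕ→ℚ n) {{normalize-nonNeg n 1}}

ℕ→ℚ-pos : ∀ n → 0ℚ < ℕ→ℚ (suc n)
ℕ→ℚ-pos n = positive⁻¹ (ℕ→ℚ (suc n)) {{normalize-pos (suc n) 1}}

-- The same embedding defined by recursion, so that the index shift
-- ⌜ suc m ⌝ = 1 + ⌜ m ⌝ of the recurrence holds definitionally.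
⌜_⌝ : ℕ → ℚ
⌜ zero  ⌝ = 0ℚ
⌜ suc m ⌝ = 1ℚ + ⌜ m ⌝

ℕ→ℚ≡⌜⌝ : ∀ m → ℕ→ℚ m ≡ ⌜ m ⌝
ℕ→ℚ≡⌜⌝ zero    = refl
ℕ→ℚ≡⌜⌝ (suc m) = trans (ℕ→ℚ-+ 1 m) (cong (1ℚ +_) (ℕ→ℚ≡⌜⌝ m))

sum-nonNeg : ∀ {p r} → 0ℚ ≤ p → 0ℚ ≤ r → 0ℚ ≤ p + r
sum-nonNeg {p} {r} p≥0 r≥0 = subst (_≤ p + r) (+-identityʳ 0ℚ) (+-mono-≤ p≥0 r≥0)

sum-pos : ∀ {p r} → 0ℚ < p → 0ℚ ≤ r → 0ℚ < p + r
sum-pos {p} {r} p>0 r≥0 =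
  positive⁻¹ (p + r) {{pos+nonNeg⇒pos p {{positive p>0}} r {{nonNegative r≥0}}}}

product-nonNeg : ∀ {p r} → 0ℚ ≤ p → 0ℚ ≤ r → 0ℚ ≤ p * r
product-nonNeg {p} {r} p≥0 r≥0 =
  nonNegative⁻¹ (p * r) {{nonNeg*nonNeg⇒nonNeg p {{nonNegative p≥0}} r {{nonNegative r≥0}}}}

product-pos : ∀ {p r} → 0ℚ < p → 0ℚ < r → 0ℚ < p * r
product-pos {p} {r} p>0 r>0 =
  positive⁻¹ (p * r) {{pos*pos⇒pos p {{positive p>0}} r {{positive r>0}}}}

difference-nonNeg : ∀ {p r} → p ≤ r → 0ℚ ≤ r - p
difference-nonNeg {p} {r} p≤r = subst (_≤ r - p) (+-inverseʳ p) (+-monoˡ-≤ (- p) p≤r)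

⌜⌝-nonNeg : ∀ m → 0ℚ ≤ ⌜ m ⌝
⌜⌝-nonNeg m = subst (0ℚ ≤_) (ℕ→ℚ≡⌜⌝ m) (ℕ→ℚ-nonNeg m)

1+-pos : ∀ {p} → 0ℚ ≤ p → 0ℚ < 1ℚ + p
1+-pos = sum-pos (ℕ→ℚ-pos 0)

≤-by-certificate : ∀ {k s l r} → 0ℚ < k → 0ℚ ≤ s → k * (r - l) ≡ s → l ≤ r
≤-by-certificate {k} {s} {l} {r} k>0 s≥0 certificate = begin
  l          ≡⟨ +-identityˡ l ⟨
  0ℚ + l     ≤⟨ +-monoˡ-≤ l 0≤r-l ⟩
  r - l + l  ≡⟨ solve 2 (λ r l → r :- l :+ l := r) refl r l ⟩
  r          ∎
  where
  open ≤-Reasoning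
  0≤r-l : 0ℚ ≤ r - l
  0≤r-l = *-cancelˡ-≤-pos k {{positive k>0}}
            (subst₂ _≤_ (sym (*-zeroʳ k)) (sym certificate) s≥0)

*-cancelˡ-≡-pos : ∀ {k p r} → 0ℚ < k → k * p ≡ k * r → p ≡ r
*-cancelˡ-≡-pos {k} k>0 kp≡kr = ≤-antisym
  (*-cancelˡ-≤-pos k {{positive k>0}} (≤-reflexive kp≡kr))
  (*-cancelˡ-≤-pos k {{positive k>0}} (≤-reflexive (sym kp≡kr)))

≤-by-evaluation : (p r : ℚ) → {True (p ≤? r)} → p ≤ r
≤-by-evaluation p r {p≤r} = toWitness p≤r

-- Three-term steps  a·w = b·z − c·y

-- w is produced from the consecutive terms y, z by the coefficients a, b, c.
-- (A record, so that the coefficients and terms can be inferred from a step.)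
record Step (a b c y z w : ℚ) : Set where
  constructor mkStep
  field relation : a * w ≡ b * z - c * y

-- The residue  a w − (b z − c y)  of a step vanishes, so subtracting any multiple
-- of it changes nothing; this discharges the recurrence inside the identities below.
step-residue : ∀ {a b c y z w} s t → Step a b c y z w →
  s - t * (a * w - (b * z - c * y)) ≡ s
step-residue {b = b} {c} {y} {z} s t (mkStep relation) =
  trans (cong (λ e → s - t * (e - (b * z - c * y))) relation)
        (solve 3 (λ s t e → s :- t :* (e :- e) := s) refl s t (b * z - c * y))

lower-ratio-step : ∀ {a b c y z w} ρ → 0ℚ < ρ * a → 0ℚ ≤ c →
  0ℚ ≤ ρ * b - ρ * ρ * a - c → 0ℚ ≤ z → ρ * y ≤ z →
  Step a b c y z w → ρ * z ≤ w
lower-ratio-step {a} {b} {c} {y} {z} {w} ρ ρa>0 c≥0 margin≥0 z≥0 ρy≤z step =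
  ≤-by-certificate ρa>0
    (sum-nonNeg (product-nonNeg margin≥0 z≥0) (product-nonNeg c≥0 (difference-nonNeg ρy≤z)))
    (trans identity (step-residue _ (- ρ) step))
  where
  identity : ρ * a * (w - ρ * z)
           ≡ (ρ * b - ρ * ρ * a - c) * z + c * (z - ρ * y) - (- ρ) * (a * w - (b * z - c * y))
  identity = solve 7 (λ ρ a b c y z w →
      ρ :* a :* (w :- ρ :* z)
    := (ρ :* b :- ρ :* ρ :* a :- c) :* z :+ c :* (z :- ρ :* y) :- (:- ρ) :* (a :* w :- (b :* z :- c :* y)))
    refl ρ a b c y z w

upper-ratio-step : ∀ {a b c y z w} p q p′ q′ → 0ℚ < p * a → 0ℚ ≤ q′ * c →
  0ℚ ≤ p * a * p′ - q′ * p * b + q′ * c * q → 0ℚ ≤ z → q * z ≤ p * y →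
  Step a b c y z w → q′ * w ≤ p′ * z
upper-ratio-step {a} {b} {c} {y} {z} {w} p q p′ q′ pa>0 q′c≥0 defect≥0 z≥0 qz≤py step =
  ≤-by-certificate pa>0
    (sum-nonNeg (product-nonNeg defect≥0 z≥0) (product-nonNeg q′c≥0 (difference-nonNeg qz≤py)))
    (trans identity (step-residue _ (q′ * p) step))
  where
  identity : p * a * (p′ * z - q′ * w)
           ≡ (p * a * p′ - q′ * p * b + q′ * c * q) * z + q′ * c * (p * y - q * z)
             - q′ * p * (a * w - (b * z - c * y))
  identity = solve 10 (λ p q p′ q′ a b c y z w →
      p :* a :* (p′ :* z :- q′ :* w)
    := (p :* a :* p′ :- q′ :* p :* b :+ q′ :* c :* q) :* z :+ q′ :* c :* (p :* y :- q :* z)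
       :- q′ :* p :* (a :* w :- (b :* z :- c :* y)))
    refl p q p′ q′ a b c y z w

log-concave-step : ∀ {a₁ b₁ c₁ a₂ b₂ c₂ x y z w} → 0ℚ < c₁ * a₂ → 0ℚ ≤ c₁ * c₂ → 0ℚ ≤ z →
  (c₂ * a₁ - c₁ * a₂) * z ≤ (c₂ * b₁ - c₁ * b₂) * y → x * z ≤ y * y →
  Step a₁ b₁ c₁ x y z → Step a₂ b₂ c₂ y z w → y * w ≤ z * z
log-concave-step {a₁} {b₁} {c₁} {a₂} {b₂} {c₂} {x} {y} {z} {w}
                 c₁a₂>0 c₁c₂≥0 z≥0 casoratian-bound xz≤y² step₁ step₂ =
  ≤-by-certificate c₁a₂>0
    (sum-nonNeg (product-nonNeg z≥0 (difference-nonNeg casoratian-bound))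
                (product-nonNeg c₁c₂≥0 (difference-nonNeg xz≤y²)))
    (trans identity (trans (step-residue _ (c₁ * y) step₂) (step-residue _ (- (c₂ * z)) step₁)))
  where
  identity : c₁ * a₂ * (z * z - y * w)
           ≡ z * ((c₂ * b₁ - c₁ * b₂) * y - (c₂ * a₁ - c₁ * a₂) * z) + c₁ * c₂ * (y * y - x * z)
             - (- (c₂ * z)) * (a₁ * z - (b₁ * y - c₁ * x)) - c₁ * y * (a₂ * w - (b₂ * z - c₂ * y))
  identity = solve 10 (λ a₁ b₁ c₁ a₂ b₂ c₂ x y z w →
      c₁ :* a₂ :* (z :* z :- y :* w)
    := z :* ((c₂ :* b₁ :- c₁ :* b₂) :* y :- (c₂ :* a₁ :- c₁ :* a₂) :* z) :+ c₁ :* c₂ :* (y :* y :- x :* z)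
       :- (:- (c₂ :* z)) :* (a₁ :* z :- (b₁ :* y :- c₁ :* x)) :- c₁ :* y :* (a₂ :* w :- (b₂ :* z :- c₂ :* y)))
    refl a₁ b₁ c₁ a₂ b₂ c₂ x y z w

-- The FLF coefficients and the polynomial identities they satisfy

-- Polynomials are written as solver syntax and evaluated, so that the ring
-- solver can check identities between them; κ is a natural-number constant.
κ : ∀ {k} → ℕ → Polynomial k
κ c = con (ℕ→ℚ c)

eval : (∀ {k} → Polynomial k → Polynomial k) → ℚ → ℚ
eval f M = ⟦ f (var zero) ⟧ (M ∷ [])

hornerₑ : ∀ {k} → List ℕ → Polynomial k → Polynomial k
hornerₑ []       M = κ 0
hornerₑ (c ∷ cs) M = κ c :+ M :* hornerₑ cs M

-- Coefficient lists of P, of Q = ((M + 2)(M + 3))², and of E, the defect of the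
-- upper ratio bound P / Q divided by 64.
P-coefficients Q-coefficients E-coefficients : List ℕ
P-coefficients = 648 ∷ 1048 ∷ 616 ∷ 160 ∷ 16 ∷ []
Q-coefficients = 36 ∷ 60 ∷ 37 ∷ 10 ∷ 1 ∷ []
E-coefficients = 10206 ∷ 38367 ∷ 62478 ∷ 58527 ∷ 35054 ∷ 14006 ∷ 3748 ∷ 649 ∷ 66 ∷ 3 ∷ []

-- In terms of M = m and n = M + 1 the FLF recurrence reads
-- a(M) V_{m+2} = b(M) V_{m+1} − c(M) V_m, with a, b, c mirroring IsFLF.
nₑ aₑ bₑ cₑ Pₑ Qₑ Eₑ : ∀ {k} → Polynomial k → Polynomial k
nₑ M = κ 1 :+ M
aₑ M = nₑ M :* (nₑ M :+ κ 1) :* (nₑ M :+ κ 1)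
bₑ M = κ 8 :* nₑ M :* (κ 3 :* nₑ M :* nₑ M :+ κ 5 :* nₑ M :+ κ 1)
cₑ M = κ 128 :* M :* (nₑ M :+ κ 1) :* (nₑ M :+ κ 1)
Pₑ M = hornerₑ P-coefficients M
Qₑ M = hornerₑ Q-coefficients M
Eₑ M = hornerₑ E-coefficients M

a b c P Q E : ℚ → ℚ
a = eval aₑ
b = eval bₑ
c = eval cₑ
P = eval Pₑ
Q = eval Qₑ
E = eval Eₑ

lower-margin : ∀ M → ℕ→ℚ 16 * b M - ℕ→ℚ 16 * ℕ→ℚ 16 * a M - c M ≡ ℕ→ℚ 128
lower-margin = solve 1 (λ M → κ 16 :* bₑ M :- κ 16 :* κ 16 :* aₑ M :- cₑ M := κ 128) refl

upper-defect : ∀ M →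
  P M * a (1ℚ + M) * P (1ℚ + M) - Q (1ℚ + M) * P M * b (1ℚ + M) + Q (1ℚ + M) * c (1ℚ + M) * Q M
  ≡ ℕ→ℚ 64 * E M
upper-defect = solve 1 (λ M →
    Pₑ M :* aₑ (κ 1 :+ M) :* Pₑ (κ 1 :+ M) :- Qₑ (κ 1 :+ M) :* Pₑ M :* bₑ (κ 1 :+ M)
      :+ Qₑ (κ 1 :+ M) :* cₑ (κ 1 :+ M) :* Qₑ M
  := κ 64 :* Eₑ M) refl

casoratian-a : ∀ M → c (1ℚ + M) * a M - c M * a (1ℚ + M) ≡ ℕ→ℚ 128 * Q M
casoratian-a = solve 1 (λ M → cₑ (κ 1 :+ M) :* aₑ M :- cₑ M :* aₑ (κ 1 :+ M) := κ 128 :* Qₑ M) refl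

casoratian-b : ∀ M → c (1ℚ + M) * b M - c M * b (1ℚ + M) ≡ ℕ→ℚ 128 * P M
casoratian-b = solve 1 (λ M → cₑ (κ 1 :+ M) :* bₑ M :- cₑ M :* bₑ (κ 1 :+ M) := κ 128 :* Pₑ M) refl

horner-nonNeg : ∀ cs {M} → 0ℚ ≤ M → 0ℚ ≤ eval (hornerₑ cs) M
horner-nonNeg []       M≥0 = ≤-refl
horner-nonNeg (c ∷ cs) M≥0 = sum-nonNeg (ℕ→ℚ-nonNeg c) (product-nonNeg M≥0 (horner-nonNeg cs M≥0))

horner-pos : ∀ c cs {M} → 0ℚ ≤ M → 0ℚ < eval (hornerₑ (suc c ∷ cs)) M
horner-pos c cs M≥0 = sum-pos (ℕ→ℚ-pos c) (product-nonNeg M≥0 (horner-nonNeg cs M≥0))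

P-pos : ∀ {M} → 0ℚ ≤ M → 0ℚ < P M
P-pos = horner-pos 647 (1048 ∷ 616 ∷ 160 ∷ 16 ∷ [])

Q-nonNeg : ∀ {M} → 0ℚ ≤ M → 0ℚ ≤ Q M
Q-nonNeg = horner-nonNeg Q-coefficients

E-nonNeg : ∀ {M} → 0ℚ ≤ M → 0ℚ ≤ E M
E-nonNeg = horner-nonNeg E-coefficients

a-pos : ∀ {M} → 0ℚ ≤ M → 0ℚ < a M
a-pos {M} M≥0 = product-pos (product-pos n>0 n+1>0) n+1>0
  where
  n>0 : 0ℚ < 1ℚ + M
  n>0 = 1+-pos M≥0
  n+1>0 : 0ℚ < 1ℚ + M + 1ℚ
  n+1>0 = sum-pos n>0 (ℕ→ℚ-nonNeg 1)

c-pos : ∀ {M} → 0ℚ < M → 0ℚ < c M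
c-pos {M} M>0 = product-pos (product-pos (product-pos (ℕ→ℚ-pos 127) M>0) n+1>0) n+1>0
  where
  n+1>0 : 0ℚ < 1ℚ + M + 1ℚ
  n+1>0 = sum-pos (1+-pos (<⇒≤ M>0)) (ℕ→ℚ-nonNeg 1)

-- Ratio bounds for consecutive terms y = V_{m+1}, z = V_{m+2} at M = m:
-- y ≥ 0 and 16 ≤ z / y ≤ P(M) / Q(M).
record RatioBounds (M y z : ℚ) : Set where
  field
    nonNeg : 0ℚ ≤ y
    lower  : ℕ→ℚ 16 * y ≤ z
    upper  : Q M * z ≤ P M * y

ratio-bounds-step : ∀ {M y z w} → 0ℚ ≤ M → RatioBounds M y z →
  Step (a (1ℚ + M)) (b (1ℚ + M)) (c (1ℚ + M)) y z w → RatioBounds (1ℚ + M) z w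
ratio-bounds-step {M} {z = z} M≥0 bounds w-step = record
  { nonNeg = z≥0
  ; lower  = lower-ratio-step (ℕ→ℚ 16) (product-pos (ℕ→ℚ-pos 15) a>0) c≥0
               (subst (0ℚ ≤_) (sym (lower-margin (1ℚ + M))) (ℕ→ℚ-nonNeg 128)) z≥0 lower w-step
  ; upper  = upper-ratio-step (P M) (Q M) (P (1ℚ + M)) (Q (1ℚ + M))
               (product-pos (P-pos M≥0) a>0)
               (product-nonNeg (Q-nonNeg (<⇒≤ n>0)) c≥0)
               (subst (0ℚ ≤_) (sym (upper-defect M))
                 (product-nonNeg (ℕ→ℚ-nonNeg 64) (E-nonNeg M≥0)))
               z≥0 upper w-step
  }
  where
  open RatioBounds bounds
  n>0 : 0ℚ < 1ℚ + M
  n>0 = 1+-pos M≥0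
  a>0 : 0ℚ < a (1ℚ + M)
  a>0 = a-pos (<⇒≤ n>0)
  c≥0 : 0ℚ ≤ c (1ℚ + M)
  c≥0 = <⇒≤ (c-pos n>0)
  z≥0 : 0ℚ ≤ z
  z≥0 = ≤-trans (product-nonNeg (ℕ→ℚ-nonNeg 16) nonNeg) lower

flf-log-concave-step : ∀ {M x y z w} → 0ℚ ≤ M → 0ℚ ≤ z →
  Q (1ℚ + M) * z ≤ P (1ℚ + M) * y → x * z ≤ y * y →
  Step (a (1ℚ + M)) (b (1ℚ + M)) (c (1ℚ + M)) x y z →
  Step (a (1ℚ + (1ℚ + M))) (b (1ℚ + (1ℚ + M))) (c (1ℚ + (1ℚ + M))) y z w →
  y * w ≤ z * z
flf-log-concave-step {M} {y = y} {z} M≥0 z≥0 upper =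
  log-concave-step (product-pos c₁>0 (a-pos (<⇒≤ (1+-pos (<⇒≤ n>0)))))
                   (product-nonNeg (<⇒≤ c₁>0) (<⇒≤ c₂>0)) z≥0 casoratian-bound
  where
  N : ℚ
  N = 1ℚ + M
  n>0 : 0ℚ < N
  n>0 = 1+-pos M≥0
  c₁>0 : 0ℚ < c N
  c₁>0 = c-pos n>0
  c₂>0 : 0ℚ < c (1ℚ + N)
  c₂>0 = c-pos (1+-pos (<⇒≤ n>0))
  casoratian-bound : (c (1ℚ + N) * a N - c N * a (1ℚ + N)) * z ≤ (c (1ℚ + N) * b N - c N * b (1ℚ + N)) * y
  casoratian-bound = begin
    (c (1ℚ + N) * a N - c N * a (1ℚ + N)) * z   ≡⟨ cong (_* z) (casoratian-a N) ⟩
    ℕ→ℚ 128 * Q N * z                           ≡⟨ *-assoc (ℕ→ℚ 128) (Q N) z ⟩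
    ℕ→ℚ 128 * (Q N * z)                         ≤⟨ *-monoˡ-≤-nonNeg (ℕ→ℚ 128) {{nonNegative (ℕ→ℚ-nonNeg 128)}} upper ⟩
    ℕ→ℚ 128 * (P N * y)                         ≡⟨ *-assoc (ℕ→ℚ 128) (P N) y ⟨
    ℕ→ℚ 128 * P N * y                           ≡⟨ cong (_* y) (casoratian-b N) ⟨
    (c (1ℚ + N) * b N - c N * b (1ℚ + N)) * y   ∎
    where open ≤-Reasoning

module _ (m : ℕ) where
  private
    n : ℕ
    n = suc m

    n≡ : ℕ→ℚ n ≡ 1ℚ + ⌜ m ⌝
    n≡ = ℕ→ℚ≡⌜⌝ n

    n+1≡ : ℕ→ℚ (n ℕ.+ 1) ≡ 1ℚ + ⌜ m ⌝ + 1ℚ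
    n+1≡ = trans (ℕ→ℚ-+ n 1) (cong (_+ 1ℚ) n≡)

    k*n≡ : ∀ k → ℕ→ℚ (k ℕ.* n) ≡ ℕ→ℚ k * (1ℚ + ⌜ m ⌝)
    k*n≡ k = trans (ℕ→ℚ-* k n) (cong (ℕ→ℚ k *_) n≡)

  cast-a : ℕ→ℚ (n ℕ.* (n ℕ.+ 1) ℕ.* (n ℕ.+ 1)) ≡ a ⌜ m ⌝
  cast-a = begin
    ℕ→ℚ (n ℕ.* (n ℕ.+ 1) ℕ.* (n ℕ.+ 1))     ≡⟨ ℕ→ℚ-* (n ℕ.* (n ℕ.+ 1)) (n ℕ.+ 1) ⟩
    ℕ→ℚ (n ℕ.* (n ℕ.+ 1)) * ℕ→ℚ (n ℕ.+ 1)   ≡⟨ cong (_* ℕ→ℚ (n ℕ.+ 1)) (ℕ→ℚ-* n (n ℕ.+ 1)) ⟩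
    ℕ→ℚ n * ℕ→ℚ (n ℕ.+ 1) * ℕ→ℚ (n ℕ.+ 1)   ≡⟨ cong₂ (λ u v → u * v * v) n≡ n+1≡ ⟩
    a ⌜ m ⌝                                 ∎
    where open ≡-Reasoning

  cast-b : ℕ→ℚ (8 ℕ.* n ℕ.* (3 ℕ.* n ℕ.* n ℕ.+ 5 ℕ.* n ℕ.+ 1)) ≡ b ⌜ m ⌝
  cast-b = begin
    ℕ→ℚ (8 ℕ.* n ℕ.* (3 ℕ.* n ℕ.* n ℕ.+ 5 ℕ.* n ℕ.+ 1))
      ≡⟨ ℕ→ℚ-* (8 ℕ.* n) (3 ℕ.* n ℕ.* n ℕ.+ 5 ℕ.* n ℕ.+ 1) ⟩
    ℕ→ℚ (8 ℕ.* n) * ℕ→ℚ (3 ℕ.* n ℕ.* n ℕ.+ 5 ℕ.* n ℕ.+ 1)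
      ≡⟨ cong (ℕ→ℚ (8 ℕ.* n) *_) (ℕ→ℚ-+ (3 ℕ.* n ℕ.* n ℕ.+ 5 ℕ.* n) 1) ⟩
    ℕ→ℚ (8 ℕ.* n) * (ℕ→ℚ (3 ℕ.* n ℕ.* n ℕ.+ 5 ℕ.* n) + 1ℚ)
      ≡⟨ cong (λ u → ℕ→ℚ (8 ℕ.* n) * (u + 1ℚ)) (ℕ→ℚ-+ (3 ℕ.* n ℕ.* n) (5 ℕ.* n)) ⟩
    ℕ→ℚ (8 ℕ.* n) * (ℕ→ℚ (3 ℕ.* n ℕ.* n) + ℕ→ℚ (5 ℕ.* n) + 1ℚ)
      ≡⟨ cong (λ u → ℕ→ℚ (8 ℕ.* n) * (u + ℕ→ℚ (5 ℕ.* n) + 1ℚ)) (ℕ→ℚ-* (3 ℕ.* n) n) ⟩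
    ℕ→ℚ (8 ℕ.* n) * (ℕ→ℚ (3 ℕ.* n) * ℕ→ℚ n + ℕ→ℚ (5 ℕ.* n) + 1ℚ)
      ≡⟨ cong₂ (λ u v → ℕ→ℚ (8 ℕ.* n) * (u * v + ℕ→ℚ (5 ℕ.* n) + 1ℚ)) (k*n≡ 3) n≡ ⟩
    ℕ→ℚ (8 ℕ.* n) * (ℕ→ℚ 3 * (1ℚ + ⌜ m ⌝) * (1ℚ + ⌜ m ⌝) + ℕ→ℚ (5 ℕ.* n) + 1ℚ)
      ≡⟨ cong₂ (λ u v → u * (ℕ→ℚ 3 * (1ℚ + ⌜ m ⌝) * (1ℚ + ⌜ m ⌝) + v + 1ℚ)) (k*n≡ 8) (k*n≡ 5) ⟩
    b ⌜ m ⌝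
      ∎
    where open ≡-Reasoning

  cast-c : ℕ→ℚ (128 ℕ.* m ℕ.* (n ℕ.+ 1) ℕ.* (n ℕ.+ 1)) ≡ c ⌜ m ⌝
  cast-c = begin
    ℕ→ℚ (128 ℕ.* m ℕ.* (n ℕ.+ 1) ℕ.* (n ℕ.+ 1))
      ≡⟨ ℕ→ℚ-* (128 ℕ.* m ℕ.* (n ℕ.+ 1)) (n ℕ.+ 1) ⟩
    ℕ→ℚ (128 ℕ.* m ℕ.* (n ℕ.+ 1)) * ℕ→ℚ (n ℕ.+ 1)
      ≡⟨ cong (_* ℕ→ℚ (n ℕ.+ 1)) (ℕ→ℚ-* (128 ℕ.* m) (n ℕ.+ 1)) ⟩
    ℕ→ℚ (128 ℕ.* m) * ℕ→ℚ (n ℕ.+ 1) * ℕ→ℚ (n ℕ.+ 1)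
      ≡⟨ cong (λ u → u * ℕ→ℚ (n ℕ.+ 1) * ℕ→ℚ (n ℕ.+ 1)) (ℕ→ℚ-* 128 m) ⟩
    ℕ→ℚ 128 * ℕ→ℚ m * ℕ→ℚ (n ℕ.+ 1) * ℕ→ℚ (n ℕ.+ 1)
      ≡⟨ cong₂ (λ u v → ℕ→ℚ 128 * u * v * v) (ℕ→ℚ≡⌜⌝ m) n+1≡ ⟩
    c ⌜ m ⌝
      ∎
    where open ≡-Reasoning

module FLF {V : ℕ → ℚ} (flf : IsFLF V) where

  recurrence : ∀ m → Step (a ⌜ m ⌝) (b ⌜ m ⌝) (c ⌜ m ⌝) (V m) (V (suc m)) (V (suc (suc m)))
  recurrence m = mkStep (trans (cong (_* V (suc (suc m))) (sym (cast-a m)))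
    (trans (proj₂ (proj₂ flf) m) (cong₂ (λ β γ → β * V (suc m) - γ * V m) (cast-b m) (cast-c m))))

  V₁ : V 1 ≡ ℕ→ℚ 8
  V₁ = proj₁ (proj₂ flf)

  V₂ : V 2 ≡ ℕ→ℚ 144
  V₂ = *-cancelˡ-≡-pos (ℕ→ℚ-pos 3)
         (trans (Step.relation (recurrence 0)) (cong₂ (λ y x → b 0ℚ * y - c 0ℚ * x) V₁ (proj₁ flf)))

  V₃ : V 3 ≡ ℕ→ℚ 2432
  V₃ = *-cancelˡ-≡-pos (ℕ→ℚ-pos 17)
         (trans (Step.relation (recurrence 1)) (cong₂ (λ y x → b ⌜ 1 ⌝ * y - c ⌜ 1 ⌝ * x) V₂ V₁))

  ratio-bounds : ∀ m → RatioBounds ⌜ m ⌝ (V (suc m)) (V (suc (suc m)))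
  ratio-bounds zero = subst₂ (RatioBounds 0ℚ) (sym V₁) (sym V₂) record
    { nonNeg = ℕ→ℚ-nonNeg 8
    ; lower  = ≤-by-evaluation (ℕ→ℚ 16 * ℕ→ℚ 8) (ℕ→ℚ 144)
    ; upper  = ≤-by-evaluation (Q 0ℚ * ℕ→ℚ 144) (P 0ℚ * ℕ→ℚ 8)
    }
  ratio-bounds (suc m) = ratio-bounds-step (⌜⌝-nonNeg m) (ratio-bounds m) (recurrence (suc m))

  initial-log-concavity : V 1 * V 3 ≤ V 2 * V 2
  initial-log-concavity = begin
    V 1 * V 3                ≡⟨ cong₂ _*_ V₁ V₃ ⟩
    ℕ→ℚ 8 * ℕ→ℚ 2432         ≤⟨ ≤-by-evaluation (ℕ→ℚ 8 * ℕ→ℚ 2432) (ℕ→ℚ 144 * ℕ→ℚ 144) ⟩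
    ℕ→ℚ 144 * ℕ→ℚ 144        ≡⟨ cong₂ _*_ V₂ V₂ ⟨
    V 2 * V 2                ∎
    where open ≤-Reasoning

theorem2p2 : (V : ℕ → ℚ) → IsFLF V →
    (m : ℕ) → V (suc m) * V (suc (suc (suc m))) ≤ V (suc (suc m)) * V (suc (suc m))
theorem2p2 V flf zero    = FLF.initial-log-concavity flf
theorem2p2 V flf (suc m) =
  flf-log-concave-step (⌜⌝-nonNeg m)
    (RatioBounds.nonNeg (ratio-bounds (suc (suc m))))
    (RatioBounds.upper (ratio-bounds (suc m)))
    (theorem2p2 V flf m)
    (recurrence (suc m)) (recurrence (suc (suc m)))
  where open FLF flf
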